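{- For every $n\ge 4$, the complete graph $K_n$ is not separable.
   Context: A graph $G=(V,E)$ is separable if there exist non-negative real weights $w(e)$, $e\in E$, and a threshold $\alpha\in\mathbb{R}$ such that for every $E'\subseteq E$: $\sum_{e\in E'}w(e)\ge\alpha$ if and only if the spanning subgraph $(V,E')$ is connected. -}

module Defs where

open import Level using (Level; _⊔_) renaming (suc to lsuc)
open import Data.Nat using (ℕ; zero; suc)
import Data.Fin as Fin
open import Data.Fin using (Fin; zero; suc; _<_; _<?_)
open import Data.Bool using (Bool; true; false; _∧_; if_then_else_)
open import Data.Product using (Σ; _×_)
open import Data.Sum using (_⊎_)
open import Function using (_∘_)
open import Relation.Nullary.Decidable using (⌊_⌋)
open import Relation.Binary.PropositionalEquality using (_≡_)
open import Relation.Binary.Core using (Rel)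
open import Relation.Binary.Structures using (IsTotalOrder)
open import Relation.Binary.Construct.Closure.ReflexiveTransitive using (Star)
open import Algebra.Bundles using (CommutativeRing)

-- Ordered commutative rings (the real numbers ℝ are an instance).
-- Agda's stdlib has no ℝ; we state the result for every ordered
-- commutative ring, which in particular covers ℝ.

record OrderedCommutativeRing (c ℓ : Level) : Set (lsuc (c ⊔ ℓ)) where
  field
    commutativeRing : CommutativeRing c ℓ
  open CommutativeRing commutativeRing public
  field
    _≤_          : Rel Carrier ℓ
    isTotalOrder : IsTotalOrder _≈_ _≤_
    +-monoˡ-≤    : ∀ z {x y} → x ≤ y → (x + z) ≤ (y + z)
    *-nonneg     : ∀ {x y} → 0# ≤ x → 0# ≤ y → 0# ≤ (x * y)

-- The complete graph K_n: vertex set Fin n, edge set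
-- E = { {i , j} | i < j }.  An edge subset E' ⊆ E is given by its
-- characteristic function; the edge {i , j} (i < j) is in E' iff
-- E' i j ≡ true (values E' i j with ¬ i < j are ignored).

EdgeSet : ℕ → Set
EdgeSet n = Fin n → Fin n → Bool

Adj : ∀ {n} → EdgeSet n → Fin n → Fin n → Set
Adj E u v = (u < v × E u v ≡ true) ⊎ (v < u × E v u ≡ true)

Connected : ∀ {n} → EdgeSet n → Set
Connected {n} E = (u v : Fin n) → Star (Adj E) u v

module _ {c ℓ} (R : OrderedCommutativeRing c ℓ) where
  open OrderedCommutativeRing R using (Carrier; 0#; _+_; _≤_)

  ∑ : ∀ {n} → (Fin n → Carrier) → Carrier
  ∑ {zero}  f = 0#
  ∑ {suc n} f = f zero + ∑ (f ∘ suc)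

  weight : ∀ {n} → (Fin n → Fin n → Carrier) → EdgeSet n → Carrier
  weight w E = ∑ λ i → ∑ λ j → if ⌊ i <? j ⌋ ∧ E i j then w i j else 0#

  SeparableComplete : ℕ → Set (c ⊔ ℓ)
  SeparableComplete n =
    Σ (Fin n → Fin n → Carrier) λ w →
    Σ Carrier λ α →
      ((i j : Fin n) → i < j → 0# ≤ w i j) ×
      ((E : EdgeSet n) →
         (α ≤ weight w E → Connected E) × (Connected E → α ≤ weight w E))

{-# OPTIONS --safe #-}
module Submission where

open import Defs
open import Data.Nat using (ℕ; zero; suc)
open import Data.Fin using (Fin; zero; suc; _<?_)
open import Data.Fin.Properties using (_≟_)
open import Data.Bool using (Bool; false; not; _∧_; if_then_else_)
open import Data.Product using (_×_; _,_; proj₁; proj₂)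
open import Data.Sum using (_⊎_; inj₁; inj₂)
import Data.Sum as Sum
open import Function using (_∘_)
open import Relation.Nullary using (¬_)
open import Relation.Nullary.Decidable using (⌊_⌋)
open import Relation.Binary.Definitions using (Symmetric)
open import Relation.Binary.PropositionalEquality using (_≡_; _≢_; refl)
open import Relation.Binary.Construct.Closure.ReflexiveTransitive using (Star; ε; _◅_; _◅◅_; reverse)
open import Relation.Binary.Structures using (IsTotalOrder)
import Relation.Binary.Reasoning.Base.Double as PreorderReasoning

-- Two spanning trees T₁, T₂ of K_n can have the same edge multiset as two disconnected graphs F₁, F₂,
-- obtained by swapping the edges at vertex 1 between T₁ and T₂.  Then w(T₁) + w(T₂) = w(F₁) + w(F₂) for every
-- weighting, while separability would force w(Tᵢ) ≥ α > w(Fᵢ).  For n ≥ 4 take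
--   T₁ = 0–{1,2,4,…,n−1} ∪ 1–3,   T₂ = 0–{1,3,4,…,n−1} ∪ 1–2,
--   F₁ = 0–{1,2,4,…,n−1} ∪ 1–2,   F₂ = 0–{1,3,4,…,n−1} ∪ 1–3,
-- where vertex 3 is isolated in F₁ and vertex 2 in F₂.

module _ {n : ℕ} {E : EdgeSet n} where

  Adj-sym : Symmetric (Adj E)
  Adj-sym = Sum.swap

  connected-if-all-reach : (c : Fin n) → (∀ u → Star (Adj E) u c) → Connected E
  connected-if-all-reach c reach u v = reach u ◅◅ reverse Adj-sym (reach v)

  isolated⇒¬connected : ∀ {v u} → (∀ x → ¬ Adj E v x) → v ≢ u → ¬ Connected E
  isolated⇒¬connected {v} {u} isolated v≢u connected with connected v u
  ... | ε        = v≢u refl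
  ... | step ◅ _ = isolated _ step

RowSwap : ∀ {n} → EdgeSet n → EdgeSet n → EdgeSet n → EdgeSet n → Set
RowSwap E₁ E₂ F₁ F₂ = ∀ i → (E₁ i ≡ F₁ i × E₂ i ≡ F₂ i) ⊎ (E₁ i ≡ F₂ i × E₂ i ≡ F₁ i)

module _ {c ℓ} (R : OrderedCommutativeRing c ℓ) where
  open OrderedCommutativeRing R renaming (refl to ≈-refl; trans to ≈-trans; zero to *-zero)
  open IsTotalOrder isTotalOrder using (total; isPreorder)
  open PreorderReasoning isPreorder

  +-monoʳ-≤ : ∀ z {x y} → x ≤ y → (z + x) ≤ (z + y)
  +-monoʳ-≤ z {x} {y} x≤y = begin
    z + x ≈⟨ +-comm z x ⟩
    x + z ≲⟨ +-monoˡ-≤ z x≤y ⟩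
    y + z ≈⟨ +-comm y z ⟩
    z + y ∎

  +-cancelʳ-≤ : ∀ z {x y} → (x + z) ≤ (y + z) → x ≤ y
  +-cancelʳ-≤ z {x} {y} x+z≤y+z = begin
    x               ≈⟨ cancel x ⟨
    x + z + - z     ≲⟨ +-monoˡ-≤ (- z) x+z≤y+z ⟩
    y + z + - z     ≈⟨ cancel y ⟩
    y               ∎
    where
    cancel : ∀ t → t + z + - z ≈ t
    cancel t = ≈-trans (+-assoc t z (- z)) (≈-trans (+-congˡ (-‿inverseʳ z)) (+-identityʳ t))

  threshold-split : ∀ {a x y u v} → a ≤ x → a ≤ y → x + y ≈ u + v → a ≤ u ⊎ a ≤ v
  threshold-split {a} {x} {y} {u} {v} a≤x a≤y x+y≈u+v with total a u
  ... | inj₁ a≤u = inj₁ a≤u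
  ... | inj₂ u≤a = inj₂ (+-cancelʳ-≤ a (begin
    a + a ≲⟨ +-monoˡ-≤ a a≤x ⟩
    x + a ≲⟨ +-monoʳ-≤ x a≤y ⟩
    x + y ≈⟨ x+y≈u+v ⟩
    u + v ≲⟨ +-monoˡ-≤ v u≤a ⟩
    a + v ≈⟨ +-comm a v ⟩
    v + a ∎))

  ∑-pairwise : ∀ {n} {f g h k : Fin n → Carrier} →
    (∀ i → f i + g i ≈ h i + k i) → ∑ R f + ∑ R g ≈ ∑ R h + ∑ R k
  ∑-pairwise {zero}  eq = ≈-refl
  ∑-pairwise {suc n} {f} {g} {h} {k} eq = begin-equality
    (f zero + ∑ R (f ∘ suc)) + (g zero + ∑ R (g ∘ suc))  ≈⟨ +-interchange ⟩
    (f zero + g zero) + (∑ R (f ∘ suc) + ∑ R (g ∘ suc))  ≈⟨ +-cong (eq zero) (∑-pairwise (eq ∘ suc)) ⟩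
    (h zero + k zero) + (∑ R (h ∘ suc) + ∑ R (k ∘ suc))  ≈⟨ +-interchange ⟨
    (h zero + ∑ R (h ∘ suc)) + (k zero + ∑ R (k ∘ suc))  ∎
    where
    +-interchange : ∀ {a b c d} → (a + b) + (c + d) ≈ (a + c) + (b + d)
    +-interchange {a} {b} {c} {d} = begin-equality
      (a + b) + (c + d) ≈⟨ +-assoc a b (c + d) ⟩
      a + (b + (c + d)) ≈⟨ +-congˡ (+-assoc b c d) ⟨
      a + ((b + c) + d) ≈⟨ +-congˡ (+-congʳ (+-comm b c)) ⟩
      a + ((c + b) + d) ≈⟨ +-congˡ (+-assoc c b d) ⟩
      a + (c + (b + d)) ≈⟨ +-assoc a c (b + d) ⟨
      (a + c) + (b + d) ∎

  weight-rowSwap : ∀ {n} (w : Fin n → Fin n → Carrier) {E₁ E₂ F₁ F₂ : EdgeSet n} →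
    RowSwap E₁ E₂ F₁ F₂ → weight R w E₁ + weight R w E₂ ≈ weight R w F₁ + weight R w F₂
  weight-rowSwap w swap = ∑-pairwise (λ i → rows-swap i (swap i))
    where
    rowWeight : ∀ i → (Fin _ → Bool) → Carrier
    rowWeight i r = ∑ R λ j → if ⌊ i <? j ⌋ ∧ r j then w i j else 0#
    rows-swap : ∀ i {r₁ r₂ s₁ s₂} → (r₁ ≡ s₁ × r₂ ≡ s₂) ⊎ (r₁ ≡ s₂ × r₂ ≡ s₁) →
      rowWeight i r₁ + rowWeight i r₂ ≈ rowWeight i s₁ + rowWeight i s₂
    rows-swap i (inj₁ (refl , refl)) = ≈-refl
    rows-swap i (inj₂ (refl , refl)) = +-comm _ _

  ¬separable-by-rowSwap : ∀ {n} {T₁ T₂ F₁ F₂ : EdgeSet n} →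
    Connected T₁ → Connected T₂ → ¬ Connected F₁ → ¬ Connected F₂ →
    RowSwap T₁ T₂ F₁ F₂ → ¬ SeparableComplete R n
  ¬separable-by-rowSwap {T₁ = T₁} {T₂} {F₁} {F₂} T₁-conn T₂-conn F₁-disc F₂-disc swap (w , _ , _ , sep)
    with threshold-split (proj₂ (sep T₁) T₁-conn) (proj₂ (sep T₂) T₂-conn) (weight-rowSwap w swap)
  ... | inj₁ α≤wF₁ = F₁-disc (proj₁ (sep F₁) α≤wF₁)
  ... | inj₂ α≤wF₂ = F₂-disc (proj₁ (sep F₂) α≤wF₂)

-- Imported only here so as not to clash with the ring's _+_ and _≤_ above.
open import Data.Nat using (_+_; _≤_; z≤n; s≤s; z<s; s<s)

module K₄₊ (m : ℕ) where

  pattern v₀ = zero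
  pattern v₁ = suc zero
  pattern v₂ = suc (suc zero)
  pattern v₃ = suc (suc (suc zero))

  V : Set
  V = Fin (4 + m)

  only allBut : V → V → Bool
  only k j = ⌊ j ≟ k ⌋
  allBut k = not ∘ only k

  -- Since entry i j only counts when i < j, this is the graph whose edges are 0–j for j > 0 in N₀
  -- and 1–j for j > 1 in N₁.
  edgesFrom₀₁ : (N₀ N₁ : V → Bool) → EdgeSet (4 + m)
  edgesFrom₀₁ N₀ N₁ v₀ = N₀
  edgesFrom₀₁ N₀ N₁ v₁ = N₁
  edgesFrom₀₁ N₀ N₁ _  = λ _ → false

  T₁ T₂ F₁ F₂ : EdgeSet (4 + m)
  T₁ = edgesFrom₀₁ (allBut v₃) (only v₃)
  T₂ = edgesFrom₀₁ (allBut v₂) (only v₂)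
  F₁ = edgesFrom₀₁ (allBut v₃) (only v₂)
  F₂ = edgesFrom₀₁ (allBut v₂) (only v₃)

  rowSwap : RowSwap T₁ T₂ F₁ F₂
  rowSwap v₀            = inj₁ (refl , refl)
  rowSwap v₁            = inj₂ (refl , refl)
  rowSwap (suc (suc _)) = inj₁ (refl , refl)

  T₁-reaches-v₀ : ∀ u → Star (Adj T₁) u v₀
  T₁-reaches-v₀ v₀                        = ε
  T₁-reaches-v₀ v₁                        = inj₂ (z<s , refl) ◅ ε
  T₁-reaches-v₀ v₂                        = inj₂ (z<s , refl) ◅ ε
  T₁-reaches-v₀ v₃                        = inj₂ (s<s z<s , refl) ◅ T₁-reaches-v₀ v₁
  T₁-reaches-v₀ (suc (suc (suc (suc _)))) = inj₂ (z<s , refl) ◅ ε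

  T₂-reaches-v₀ : ∀ u → Star (Adj T₂) u v₀
  T₂-reaches-v₀ v₀                        = ε
  T₂-reaches-v₀ v₁                        = inj₂ (z<s , refl) ◅ ε
  T₂-reaches-v₀ v₂                        = inj₂ (s<s z<s , refl) ◅ T₂-reaches-v₀ v₁
  T₂-reaches-v₀ v₃                        = inj₂ (z<s , refl) ◅ ε
  T₂-reaches-v₀ (suc (suc (suc (suc _)))) = inj₂ (z<s , refl) ◅ ε

  v₃-isolated-in-F₁ : ∀ x → ¬ Adj F₁ v₃ x
  v₃-isolated-in-F₁ _             (inj₁ (_ , ()))
  v₃-isolated-in-F₁ v₀            (inj₂ (_ , ()))
  v₃-isolated-in-F₁ v₁            (inj₂ (_ , ()))
  v₃-isolated-in-F₁ (suc (suc _)) (inj₂ (_ , ()))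

  v₂-isolated-in-F₂ : ∀ x → ¬ Adj F₂ v₂ x
  v₂-isolated-in-F₂ _             (inj₁ (_ , ()))
  v₂-isolated-in-F₂ v₀            (inj₂ (_ , ()))
  v₂-isolated-in-F₂ v₁            (inj₂ (_ , ()))
  v₂-isolated-in-F₂ (suc (suc _)) (inj₂ (_ , ()))

  ¬separable : ∀ {c ℓ} (R : OrderedCommutativeRing c ℓ) → ¬ SeparableComplete R (4 + m)
  ¬separable R = ¬separable-by-rowSwap R
    (connected-if-all-reach v₀ T₁-reaches-v₀)
    (connected-if-all-reach v₀ T₂-reaches-v₀)
    (isolated⇒¬connected {u = v₀} v₃-isolated-in-F₁ λ ())
    (isolated⇒¬connected {u = v₀} v₂-isolated-in-F₂ λ ())
    rowSwap

proposition1 : ∀ {c ℓ} (R : OrderedCommutativeRing c ℓ) (n : ℕ) →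
    4 ≤ n → ¬ SeparableComplete R n
proposition1 R (suc (suc (suc (suc m)))) (s≤s (s≤s (s≤s (s≤s z≤n)))) = K₄₊.¬separable m R
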